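{- Let $n,c\ge 2$ and $1\le s\le c-1$ be integers, let $t=\lceil sn/c\rceil$ and let $\lambda\in[c]$ satisfy $\lambda\equiv sn\pmod c$. If $q\ge\frac{t}{n-t+1}\left(\binom{n}{t}-m(n,t,\lambda;s+1,c-s+1)\right)$, then \[f^q_{c,s}(n)\le\frac{\binom{n}{t}}{\binom{n}{t}-m(n,t,\lambda;s+1,c-s+1)}\,q^t.\]
   Context: $[m]=\{1,\dots,m\}$. A code $\mathcal{C}\subseteq[q]^n$ is $(c,s)$-frameproof if for every $c+1$ codewords $\bm x^0,\dots,\bm x^c\in\mathcal{C}$ with $\bm x^0\neq\bm x^j$ for each $j\in[c]$ ($\bm x^1,\dots,\bm x^c$ not necessarily distinct), there is a coordinate $i\in[n]$ with $|\{j\in[c]:x^j_i=x^0_i\}|<s$. $f^q_{c,s}(n)$ is the maximum size of a $(c,s)$-frameproof code in $[q]^n$. A sequence $A_1,\dots,A_\lambda$ of subsets of $[n]$ (repetitions allowed) is $(k_1,k_2)$-disjoint if $\bigcap_{i\in B}A_i=\emptyset$ for every $k_1$-subset $B\subseteq[\lambda]$ and $\bigcup_{i\in B}A_i=[n]$ for every $k_2$-subset $B\subseteq[\lambda]$ (each condition vacuous if the subset size exceeds $\lambda$). $m(n,t,\lambda;k_1,k_2)$ is the maximum size of a family of $t$-subsets of $[n]$ containing no $A_1,\dots,A_\lambda$ (not necessarily distinct members) forming a $(k_1,k_2)$-disjoint sequence. -}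

module Defs where

open import Data.Nat using (ℕ; _+_; _*_; _∸_; _≤_; _<_; NonZero)
open import Data.Nat.DivMod using (_/_)
open import Data.Fin using (Fin; _≟_)
open import Data.Fin.Subset using (Subset; _∈_; ∣_∣)
open import Data.Vec using (Vec; lookup)
open import Data.List using (List; length; filter; allFin)
open import Data.List.Relation.Unary.All using (All)
open import Data.List.Relation.Unary.Unique.Propositional using (Unique)
import Data.List.Membership.Propositional as L
open import Data.Product using (Σ; ∃; _×_)
open import Relation.Binary.PropositionalEquality using (_≡_; _≢_)
open import Relation.Nullary using (¬_)

⌈_/_⌉ : ℕ → (d : ℕ) → .{{NonZero d}} → ℕ
⌈ a / d ⌉ = (a + (d ∸ 1)) / d

Word : ℕ → ℕ → Set
Word q n = Vec (Fin q) n

-- a code is a duplicate-free list of words; its size is its length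
record Code (q n : ℕ) : Set where
  constructor mkCode
  field
    words  : List (Word q n)
    unique : Unique words
open Code public

agreeCount : ∀ {q n c} → (Fin c → Word q n) → Word q n → Fin n → ℕ
agreeCount {c = c} xs x0 i =
  length (filter (λ j → lookup (xs j) i ≟ lookup x0 i) (allFin c))

IsFrameproof : ∀ {q n} → (c s : ℕ) → Code q n → Set
IsFrameproof {q} {n} c s C =
  ∀ (x0 : Word q n) (xs : Fin c → Word q n) →
    x0 L.∈ words C →
    (∀ j → xs j L.∈ words C) →
    (∀ j → x0 ≢ xs j) →
    ∃ λ (i : Fin n) → agreeCount xs x0 i < s

IsDisjointSeq : ∀ {n λ′} → (k₁ k₂ : ℕ) → (Fin λ′ → Subset n) → Set
IsDisjointSeq {n} {λ′} k₁ k₂ A =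
  (∀ (B : Subset λ′) → ∣ B ∣ ≡ k₁ →
     ∀ (x : Fin n) → ¬ (∀ i → i ∈ B → x ∈ A i))
  ×
  (∀ (B : Subset λ′) → ∣ B ∣ ≡ k₂ →
     ∀ (x : Fin n) → ∃ λ i → i ∈ B × x ∈ A i)

-- family of t-subsets of [n] (duplicate-free list) with no (k₁,k₂)-disjoint
-- sequence of λ members (members not necessarily distinct)
IsAdmissibleFamily : (n t λ′ k₁ k₂ : ℕ) → List (Subset n) → Set
IsAdmissibleFamily n t λ′ k₁ k₂ F =
  Unique F ×
  All (λ A → ∣ A ∣ ≡ t) F ×
  (∀ (A : Fin λ′ → Subset n) → (∀ i → A i L.∈ F) → ¬ IsDisjointSeq k₁ k₂ A)

IsM : (n t λ′ k₁ k₂ M : ℕ) → Set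
IsM n t λ′ k₁ k₂ M =
  (∃ λ F → IsAdmissibleFamily n t λ′ k₁ k₂ F × length F ≡ M) ×
  (∀ F → IsAdmissibleFamily n t λ′ k₁ k₂ F → length F ≤ M)

module Submission where

-- Call T ⊆ [n] identifying for a codeword x if no other codeword agrees with x on T; let
-- t = ⌈sn/c⌉ and N = C(n,t). Double count weighted pairs (T, j) with |T| = t and j ∈ T.
-- A codeword x with an identifying (t−1)-set S claims every pair (S ∪ {j}, j) with weight q,
-- in total q(n − t + 1) ≥ t(N − M). Any other codeword claims (T, j) with weight 1 for each
-- identifying t-set T. Its non-identifying t-sets form an admissible family: were λ of them
-- (s+1, c−s+1)-disjoint, every coordinate would lie in between s − (c − λ) and s of them, and
-- since sn = λt + (c − λ)(t − 1) the missing multiplicities can be covered by c − λ further sets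
-- of size t − 1, which are non-identifying too; the c codewords witnessing non-identification
-- then agree with x at least s times in every coordinate, against frameproofness. So x has at
-- least N − M identifying t-sets and weight at least t(N − M). Conversely, a pair (T, j) carries
-- weight at most q^t: the q variants in coordinate j of the claimants of the first kind and the
-- claimants of the second kind have pairwise distinct restrictions to T. Hence
-- |C| t (N − M) ≤ N t q^t.

open import Defs
open import Data.Bool using (Bool; true; false; not)
import Data.Bool.Properties as Boolₚ
open import Data.Empty using (⊥; ⊥-elim)
open import Data.Fin using (Fin; zero; suc; _↑ˡ_; _↑ʳ_)
import Data.Fin.Properties as Fin
open import Data.Fin.Subset using (Subset; inside; outside; ⊤; _∈_; _∉_; _⊆_; ∣_∣; ∁)
open import Data.Fin.Subset.Properties
open import Data.List using (List; []; _∷_; _++_; length; filter; allFin; tabulate; map; concatMap)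
import Data.List as List using (find)
import Data.List.Properties as Listₚ
open import Data.List.Membership.Propositional using (lose; find) renaming (_∈_ to _∈ˡ_)
open import Data.List.Membership.Propositional.Properties
import Data.List.Relation.Unary.Any as Any
open import Data.List.Relation.Unary.All using (All; []; _∷_)
import Data.List.Relation.Unary.All as All
open import Data.List.Relation.Unary.All.Properties using (¬All⇒Any¬)
import Data.List.Relation.Unary.All.Properties as Allₚ
open import Data.List.Relation.Unary.AllPairs using (AllPairs; []; _∷_)
import Data.List.Relation.Unary.AllPairs.Properties as AllPairsₚ
open import Data.List.Relation.Unary.Unique.Propositional using (Unique)
import Data.List.Relation.Unary.Unique.Propositional.Properties as Uniqueₚ
open import Data.Maybe using (Maybe; just; nothing)
import Data.Maybe.Properties as Maybeₚ
open import Data.Nat using (ℕ; zero; suc; _+_; _*_; _∸_; _^_; _≤_; _<_; z≤n; s≤s; _≤?_; NonZero; >-nonZero; >-nonZero⁻¹)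
open import Data.Nat.Combinatorics using (_C_; nCk+nC[k+1]≡[n+1]C[k+1])
open import Data.Nat.DivMod
  using (_%_; m≡m%n+[m/n]*n; m%n<n; m/n*n≤m; m<n⇒m%n≡m; n%n≡0; m≥n⇒m/n>0; [m+kn]%n≡m%n)
open import Data.Nat.Properties
open import Data.Nat.Solver using (module +-*-Solver)
open +-*-Solver using (solve; _:+_; _:*_; _:=_; con)
open import Algebra.Properties.CommutativeSemigroup +-commutativeSemigroup
  using () renaming (interchange to +-interchange; x∙yz≈y∙xz to x+[y+z]≡y+[x+z])
open import Algebra.Properties.CommutativeSemigroup *-commutativeSemigroup
  using () renaming (x∙yz≈y∙xz to x*[y*z]≡y*[x*z])
open import Data.Product using (∃; _×_; _,_; proj₁; proj₂)
import Data.Product as Product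
open import Data.Sum using (inj₁; inj₂)
open import Data.Vec using (Vec; []; _∷_; lookup; _[_]≔_; here; there)
import Data.Vec as Vec
import Data.Vec.Properties as Vecₚ
import Data.Vec.Functional as Vector
import Data.Vec.Functional.Properties as Vectorₚ
import Data.Vec.Functional.Relation.Unary.All.Properties as VectorAllₚ
open import Function using (_∘_; id)
open import Level using (Level)
open import Relation.Binary using (DecidableEquality)
open import Relation.Binary.PropositionalEquality
open import Relation.Nullary using (¬_; Dec; yes; no; does; contradiction)
open import Relation.Nullary.Decidable using (dec-true; dec-false; ¬?; _→-dec_; _×-dec_)
open import Relation.Unary using (Pred; Decidable)

private
  variable
    a b : Level
    A B : Set a

-- Finite sums

∑ : List A → (A → ℕ) → ℕ
∑ []       f = 0
∑ (x ∷ xs) f = f x + ∑ xs f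

infix 9 ∑

syntax ∑ xs (λ x → e) = ∑[ x ← xs ] e

𝟙 : Bool → ℕ
𝟙 true  = 1
𝟙 false = 0


∑-cong : ∀ (xs : List A) {f g : A → ℕ} → (∀ {x} → x ∈ˡ xs → f x ≡ g x) → ∑ xs f ≡ ∑ xs g
∑-cong []       eq = refl
∑-cong (x ∷ xs) eq = cong₂ _+_ (eq (Any.here refl)) (∑-cong xs (eq ∘ Any.there))

∑-mono-≤ : ∀ (xs : List A) {f g : A → ℕ} → (∀ {x} → x ∈ˡ xs → f x ≤ g x) → ∑ xs f ≤ ∑ xs g
∑-mono-≤ []       le = z≤n
∑-mono-≤ (x ∷ xs) le = +-mono-≤ (le (Any.here refl)) (∑-mono-≤ xs (le ∘ Any.there))

∑-distrib-+ : ∀ (xs : List A) (f g : A → ℕ) → ∑[ x ← xs ] (f x + g x) ≡ ∑ xs f + ∑ xs g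
∑-distrib-+ []       f g = refl
∑-distrib-+ (x ∷ xs) f g =
  trans (cong (f x + g x +_) (∑-distrib-+ xs f g)) (+-interchange (f x) (g x) (∑ xs f) (∑ xs g))

∑-*-distribˡ : ∀ (xs : List A) k (f : A → ℕ) → ∑[ x ← xs ] (k * f x) ≡ k * ∑ xs f
∑-*-distribˡ []       k f = sym (*-zeroʳ k)
∑-*-distribˡ (x ∷ xs) k f =
  trans (cong (k * f x +_) (∑-*-distribˡ xs k f)) (sym (*-distribˡ-+ k (f x) (∑ xs f)))

∑-*-distribʳ : ∀ (xs : List A) (f : A → ℕ) k → ∑[ x ← xs ] (f x * k) ≡ ∑ xs f * k
∑-*-distribʳ xs f k = trans (∑-cong xs (λ {x} _ → *-comm (f x) k)) (trans (∑-*-distribˡ xs k f) (*-comm k (∑ xs f)))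

∑-const : ∀ (xs : List A) k → ∑[ _ ← xs ] k ≡ length xs * k
∑-const []       k = refl
∑-const (x ∷ xs) k = cong (k +_) (∑-const xs k)

∑-count : ∀ (xs : List A) → ∑[ _ ← xs ] 1 ≡ length xs
∑-count xs = trans (∑-const xs 1) (*-identityʳ (length xs))

∑-∸ : ∀ (xs : List A) {f g : A → ℕ} → (∀ {x} → x ∈ˡ xs → g x ≤ f x) →
      ∑[ x ← xs ] (f x ∸ g x) + ∑ xs g ≡ ∑ xs f
∑-∸ xs {f} {g} g≤f = trans (sym (∑-distrib-+ xs _ g)) (∑-cong xs (λ x∈ → m∸n+n≡m (g≤f x∈)))

∈⇒≤∑ : ∀ {xs : List A} (f : A → ℕ) {x} → x ∈ˡ xs → f x ≤ ∑ xs f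
∈⇒≤∑ {xs = y ∷ xs} f (Any.here refl) = m≤m+n (f y) (∑ xs f)
∈⇒≤∑ {xs = y ∷ xs} f (Any.there x∈) = ≤-trans (∈⇒≤∑ f x∈) (m≤n+m (∑ xs f) (f y))

length-filter≡∑ : ∀ {p} {P : Pred A p} (P? : Decidable P) (xs : List A) →
                  length (filter P? xs) ≡ ∑[ x ← xs ] 𝟙 (does (P? x))
length-filter≡∑ P? []       = refl
length-filter≡∑ P? (x ∷ xs) with P? x
... | yes _ = cong suc (length-filter≡∑ P? xs)
... | no  _ = length-filter≡∑ P? xs

length-filter+length-filter¬ : ∀ {p} {P : Pred A p} (P? : Decidable P) xs →
                               length (filter P? xs) + length (filter (¬? ∘ P?) xs) ≡ length xs
length-filter+length-filter¬ P? []       = refl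
length-filter+length-filter¬ P? (x ∷ xs) with P? x
... | yes _ = cong suc (length-filter+length-filter¬ P? xs)
... | no  _ = trans (+-suc _ _) (cong suc (length-filter+length-filter¬ P? xs))

find-just : ∀ {p} {P : Pred A p} (P? : Decidable P) xs {x} → List.find P? xs ≡ just x → P x × x ∈ˡ xs
find-just P? (y ∷ xs) eq with P? y
find-just P? (y ∷ xs) refl | yes py = py , Any.here refl
... | no _ = Product.map₂ Any.there (find-just P? xs eq)

find-nothing : ∀ {p} {P : Pred A p} (P? : Decidable P) xs → List.find P? xs ≡ nothing → ∀ {x} → x ∈ˡ xs → ¬ P x
find-nothing P? (y ∷ xs) eq x∈ with P? y
find-nothing P? (y ∷ xs) () x∈              | yes _
find-nothing P? (y ∷ xs) eq (Any.here refl) | no ¬py = ¬py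
find-nothing P? (y ∷ xs) eq (Any.there x∈)  | no _   = find-nothing P? xs eq x∈

AllPairs-mapWith∈ : ∀ {r s} {R : A → A → Set r} {S : A → A → Set s} {xs} →
                    (∀ {x y} → x ∈ˡ xs → y ∈ˡ xs → R x y → S x y) → AllPairs R xs → AllPairs S xs
AllPairs-mapWith∈ f []         = []
AllPairs-mapWith∈ f (Rx ∷ Rxs) =
  All.tabulate (λ y∈ → f (Any.here refl) (Any.there y∈) (All.lookup Rx y∈)) ∷
  AllPairs-mapWith∈ (λ x∈ y∈ → f (Any.there x∈) (Any.there y∈)) Rxs

∑-comm : ∀ (xs : List A) (ys : List B) (f : A → B → ℕ) →
         ∑[ x ← xs ] (∑ ys (f x)) ≡ ∑[ y ← ys ] ∑[ x ← xs ] f x y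
∑-comm []       ys f = sym (trans (∑-const ys 0) (*-zeroʳ (length ys)))
∑-comm (x ∷ xs) ys f =
  trans (cong (∑ ys (f x) +_) (∑-comm xs ys f)) (sym (∑-distrib-+ ys (f x) _))

length-concatMap : ∀ (g : A → List B) (xs : List A) → length (concatMap g xs) ≡ ∑[ x ← xs ] length (g x)
length-concatMap g []       = refl
length-concatMap g (x ∷ xs) =
  trans (Listₚ.length-++ (g x)) (cong (length (g x) +_) (length-concatMap g xs))

∑-tabulate : ∀ {n} (g : Fin n → A) (f : A → ℕ) → ∑ (tabulate g) f ≡ ∑[ i ← allFin n ] f (g i)
∑-tabulate {n = zero}  g f = refl
∑-tabulate {n = suc n} g f = cong (f (g zero) +_) (begin
  ∑ (tabulate (g ∘ suc)) f          ≡⟨ ∑-tabulate (g ∘ suc) f ⟩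
  ∑[ i ← allFin n ] f (g (suc i))   ≡⟨ ∑-tabulate suc (f ∘ g) ⟨
  ∑ (tabulate suc) (f ∘ g)          ∎)
  where open ≡-Reasoning

∑-allFin-suc : ∀ {n} (f : Fin (suc n) → ℕ) → ∑ (allFin (suc n)) f ≡ f zero + ∑[ i ← allFin n ] f (suc i)
∑-allFin-suc f = cong (f zero +_) (∑-tabulate suc f)

∑-allFin-+ : ∀ m {n} (f : Fin (m + n) → ℕ) →
             ∑ (allFin (m + n)) f ≡ ∑[ i ← allFin m ] f (i ↑ˡ n) + ∑[ k ← allFin n ] f (m ↑ʳ k)
∑-allFin-+ zero    f = refl
∑-allFin-+ (suc m) {n} f = begin
  ∑ (allFin (suc m + n)) f                                          ≡⟨ ∑-allFin-suc f ⟩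
  f zero + ∑[ j ← allFin (m + n) ] f (suc j)                        ≡⟨ cong (f zero +_) (∑-allFin-+ m (f ∘ suc)) ⟩
  f zero + (∑[ i ← allFin m ] f (suc (i ↑ˡ n)) + ∑ (allFin n) g)    ≡⟨ +-assoc (f zero) _ _ ⟨
  f zero + ∑[ i ← allFin m ] f (suc (i ↑ˡ n)) + ∑ (allFin n) g
    ≡⟨ cong (_+ ∑ (allFin n) g) (∑-allFin-suc (λ i → f (i ↑ˡ n))) ⟨
  ∑[ i ← allFin (suc m) ] f (i ↑ˡ n) + ∑ (allFin n) g               ∎
  where
  open ≡-Reasoning
  g : Fin n → ℕ
  g k = f (suc m ↑ʳ k)

-- Subsets of Fin n

∣p∣≡∑𝟙 : ∀ {n} (p : Subset n) → ∣ p ∣ ≡ ∑[ i ← allFin n ] 𝟙 (lookup p i)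
∣p∣≡∑𝟙 []            = refl
∣p∣≡∑𝟙 (inside ∷ p)  = cong suc (trans (∣p∣≡∑𝟙 p) (sym (∑-tabulate suc (𝟙 ∘ lookup (inside ∷ p)))))
∣p∣≡∑𝟙 (outside ∷ p) = trans (∣p∣≡∑𝟙 p) (sym (∑-tabulate suc (𝟙 ∘ lookup (outside ∷ p))))

⊆-between : ∀ {n} {p r : Subset n} k → p ⊆ r → ∣ p ∣ ≤ k → k ≤ ∣ r ∣ →
            ∃ λ q → p ⊆ q × q ⊆ r × ∣ q ∣ ≡ k
⊆-between {p = []} {[]} zero p⊆r _ _ = [] , p⊆r , p⊆r , refl
⊆-between {p = inside ∷ p} {outside ∷ r} k p⊆r _ _ with () ← p⊆r here
⊆-between {p = outside ∷ p} {outside ∷ r} k p⊆r p≤k k≤r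
  with q , p⊆q , q⊆r , ∣q∣≡k ← ⊆-between k (drop-∷-⊆ p⊆r) p≤k k≤r
  = outside ∷ q , s⊆s p⊆q , s⊆s q⊆r , ∣q∣≡k
⊆-between {p = inside ∷ p} {inside ∷ r} (suc k) p⊆r (s≤s p≤k) (s≤s k≤r)
  with q , p⊆q , q⊆r , ∣q∣≡k ← ⊆-between k (drop-∷-⊆ p⊆r) p≤k k≤r
  = inside ∷ q , s⊆s p⊆q , s⊆s q⊆r , cong suc ∣q∣≡k
⊆-between {p = outside ∷ p} {inside ∷ r} k p⊆r p≤k k≤1+r with k ≤? ∣ r ∣
... | no k≰r = inside ∷ r , p⊆r , ⊆-refl , ≤-antisym (≰⇒> k≰r) k≤1+r
... | yes k≤r
  with q , p⊆q , q⊆r , ∣q∣≡k ← ⊆-between k (drop-∷-⊆ p⊆r) p≤k k≤r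
  = outside ∷ q , s⊆s p⊆q , out⊆ q⊆r , ∣q∣≡k

⊆-choose : ∀ {n} {r : Subset n} k → k ≤ ∣ r ∣ → ∃ λ q → q ⊆ r × ∣ q ∣ ≡ k
⊆-choose {n} k k≤∣r∣ with q , _ , q⊆r , ∣q∣≡k ← ⊆-between k ⊥⊆ (≤-trans (≤-reflexive (∣⊥∣≡0 n)) z≤n) k≤∣r∣ =
  q , q⊆r , ∣q∣≡k

∉⇒lookup≡outside : ∀ {n} {p : Subset n} {i} → i ∉ p → lookup p i ≡ outside
∉⇒lookup≡outside {p = p} {i} i∉p with lookup p i in eq
... | outside = refl
... | inside  = ⊥-elim (i∉p (Vecₚ.lookup⇒[]= i p eq))

lookup≡outside⇒∉ : ∀ {n} {p : Subset n} {i} → lookup p i ≡ outside → i ∉ p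
lookup≡outside⇒∉ eq i∈p with () ← trans (sym (Vecₚ.[]=⇒lookup i∈p)) eq

p[i]≔outside⊆p : ∀ {n} (p : Subset n) i → p [ i ]≔ outside ⊆ p
p[i]≔outside⊆p (x ∷ p) zero    (there j∈) = there j∈
p[i]≔outside⊆p (x ∷ p) (suc i) here       = here
p[i]≔outside⊆p (x ∷ p) (suc i) (there j∈) = there (p[i]≔outside⊆p p i j∈)

i∉p[i]≔outside : ∀ {n} (p : Subset n) i → i ∉ p [ i ]≔ outside
i∉p[i]≔outside (x ∷ p) (suc i) (there i∈) = i∉p[i]≔outside p i i∈

∣p[i]≔inside∣ : ∀ {n} {p : Subset n} {i} → i ∉ p → ∣ p [ i ]≔ inside ∣ ≡ suc ∣ p ∣
∣p[i]≔inside∣ {p = outside ∷ p} {zero}  _   = refl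
∣p[i]≔inside∣ {p = inside ∷ p}  {zero}  i∉p = ⊥-elim (i∉p here)
∣p[i]≔inside∣ {p = inside ∷ p}  {suc i} i∉p = cong suc (∣p[i]≔inside∣ (i∉p ∘ there))
∣p[i]≔inside∣ {p = outside ∷ p} {suc i} i∉p = ∣p[i]≔inside∣ (i∉p ∘ there)

p[i]≔inside[i]≔outside : ∀ {n} {p : Subset n} {i} → i ∉ p → (p [ i ]≔ inside) [ i ]≔ outside ≡ p
p[i]≔inside[i]≔outside {p = p} {i} i∉p = begin
  (p [ i ]≔ inside) [ i ]≔ outside ≡⟨ Vecₚ.[]≔-idempotent p i ⟩
  p [ i ]≔ outside                 ≡⟨ cong (p [ i ]≔_) (∉⇒lookup≡outside i∉p) ⟨
  p [ i ]≔ lookup p i              ≡⟨ Vecₚ.[]≔-lookup p i ⟩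
  p                                ∎
  where open ≡-Reasoning

∑𝟙∁≡n∸∣p∣ : ∀ {n} (p : Subset n) → ∑[ i ← allFin n ] 𝟙 (not (lookup p i)) ≡ n ∸ ∣ p ∣
∑𝟙∁≡n∸∣p∣ {n} p = begin
  ∑[ i ← allFin n ] 𝟙 (not (lookup p i)) ≡⟨ ∑-cong (allFin n) (λ {i} _ → cong 𝟙 (Vecₚ.lookup-map i not p)) ⟨
  ∑[ i ← allFin n ] 𝟙 (lookup (∁ p) i)   ≡⟨ ∣p∣≡∑𝟙 (∁ p) ⟨
  ∣ ∁ p ∣                                ≡⟨ ∣∁p∣≡n∸∣p∣ p ⟩
  n ∸ ∣ p ∣                              ∎
  where open ≡-Reasoning

subsetsOfSize : ∀ n → ℕ → List (Subset n)
subsetsOfSize zero    zero    = [] ∷ []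
subsetsOfSize zero    (suc k) = []
subsetsOfSize (suc n) zero    = map (outside ∷_) (subsetsOfSize n zero)
subsetsOfSize (suc n) (suc k) = map (inside ∷_) (subsetsOfSize n k) ++ map (outside ∷_) (subsetsOfSize n (suc k))

∈-subsetsOfSize⁻ : ∀ n k {p} → p ∈ˡ subsetsOfSize n k → ∣ p ∣ ≡ k
∈-subsetsOfSize⁻ zero zero (Any.here refl) = refl
∈-subsetsOfSize⁻ (suc n) zero p∈
  with _ , p∈′ , refl ← ∈-map⁻ (outside ∷_) p∈ = ∈-subsetsOfSize⁻ n zero p∈′
∈-subsetsOfSize⁻ (suc n) (suc k) p∈ with ∈-++⁻ (map (inside ∷_) (subsetsOfSize n k)) p∈
... | inj₁ p∈ˡ with _ , p∈′ , refl ← ∈-map⁻ (inside ∷_) p∈ˡ = cong suc (∈-subsetsOfSize⁻ n k p∈′)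
... | inj₂ p∈ʳ with _ , p∈′ , refl ← ∈-map⁻ (outside ∷_) p∈ʳ = ∈-subsetsOfSize⁻ n (suc k) p∈′

∈-subsetsOfSize⁺ : ∀ n k (p : Subset n) → ∣ p ∣ ≡ k → p ∈ˡ subsetsOfSize n k
∈-subsetsOfSize⁺ zero    zero    []            _ = Any.here refl
∈-subsetsOfSize⁺ (suc n) zero    (outside ∷ p) e = ∈-map⁺ (outside ∷_) (∈-subsetsOfSize⁺ n zero p e)
∈-subsetsOfSize⁺ (suc n) (suc k) (inside ∷ p)  e =
  ∈-++⁺ˡ (∈-map⁺ (inside ∷_) (∈-subsetsOfSize⁺ n k p (suc-injective e)))
∈-subsetsOfSize⁺ (suc n) (suc k) (outside ∷ p) e =
  ∈-++⁺ʳ (map (inside ∷_) (subsetsOfSize n k)) (∈-map⁺ (outside ∷_) (∈-subsetsOfSize⁺ n (suc k) p e))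

subsetsOfSize-unique : ∀ n k → Unique (subsetsOfSize n k)
subsetsOfSize-unique zero    zero    = [] ∷ []
subsetsOfSize-unique zero    (suc k) = []
subsetsOfSize-unique (suc n) zero    = Uniqueₚ.map⁺ Vecₚ.∷-injectiveʳ (subsetsOfSize-unique n zero)
subsetsOfSize-unique (suc n) (suc k) = Uniqueₚ.++⁺
  (Uniqueₚ.map⁺ Vecₚ.∷-injectiveʳ (subsetsOfSize-unique n k))
  (Uniqueₚ.map⁺ Vecₚ.∷-injectiveʳ (subsetsOfSize-unique n (suc k)))
  λ (p∈ˡ , p∈ʳ) → heads-differ (∈-map⁻ (inside ∷_) p∈ˡ) (∈-map⁻ (outside ∷_) p∈ʳ)
  where
  heads-differ : ∀ {p : Subset (suc n)} → (∃ λ q → _ × p ≡ inside ∷ q) → (∃ λ q → _ × p ≡ outside ∷ q) → ⊥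
  heads-differ (_ , _ , refl) (_ , _ , ())

length-subsetsOfSize : ∀ n k → length (subsetsOfSize n k) ≡ n C k
length-subsetsOfSize zero    zero    = refl
length-subsetsOfSize zero    (suc k) = refl
length-subsetsOfSize (suc n) zero    = trans (Listₚ.length-map _ (subsetsOfSize n zero)) (length-subsetsOfSize n zero)
length-subsetsOfSize (suc n) (suc k) = begin
  length (map (inside ∷_) (subsetsOfSize n k) ++ map (outside ∷_) (subsetsOfSize n (suc k)))
    ≡⟨ Listₚ.length-++ (map (inside ∷_) (subsetsOfSize n k)) ⟩
  length (map (inside ∷_) (subsetsOfSize n k)) + length (map (outside ∷_) (subsetsOfSize n (suc k)))
    ≡⟨ cong₂ _+_ (Listₚ.length-map _ (subsetsOfSize n k)) (Listₚ.length-map _ (subsetsOfSize n (suc k))) ⟩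
  length (subsetsOfSize n k) + length (subsetsOfSize n (suc k))
    ≡⟨ cong₂ _+_ (length-subsetsOfSize n k) (length-subsetsOfSize n (suc k)) ⟩
  n C k + n C suc k
    ≡⟨ nCk+nC[k+1]≡[n+1]C[k+1] n k ⟩
  suc n C suc k ∎
  where open ≡-Reasoning

-- Counting words by their restrictions

module _ (_≟_ : DecidableEquality A) where

  private
    occurrences : A → List A → ℕ
    occurrences y xs = ∑[ x ← xs ] 𝟙 (does (y ≟ x))

    occurrences-unique : ∀ {xs} → Unique xs → ∀ y → occurrences y xs ≤ 1
    occurrences-unique []                 y = z≤n
    occurrences-unique {x ∷ xs} (x∉ ∷ u) y with y ≟ x
    ... | no  _    = occurrences-unique u y
    ... | yes refl = s≤s (≤-reflexive (absent xs x∉))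
      where
      absent : ∀ zs → All (y ≢_) zs → occurrences y zs ≡ 0
      absent []       []          = refl
      absent (z ∷ zs) (y≢z ∷ y∉) rewrite dec-false (y ≟ z) y≢z = absent zs y∉

    occurrences-∈ : ∀ {x} ys → x ∈ˡ ys → 1 ≤ ∑[ y ← ys ] 𝟙 (does (y ≟ x))
    occurrences-∈ {x} ys x∈ = ≤-trans (≤-reflexive (cong 𝟙 (sym (dec-true (x ≟ x) refl))))
                                       (∈⇒≤∑ (λ y → 𝟙 (does (y ≟ x))) x∈)

  unique-⊆⇒length≤ : ∀ {xs ys : List A} → Unique xs → (∀ {x} → x ∈ˡ xs → x ∈ˡ ys) → length xs ≤ length ys
  unique-⊆⇒length≤ {xs} {ys} u xs⊆ys = begin
    length xs                       ≡⟨ ∑-count xs ⟨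
    ∑[ _ ← xs ] 1                   ≤⟨ ∑-mono-≤ xs (occurrences-∈ ys ∘ xs⊆ys) ⟩
    ∑[ x ← xs ] ∑[ y ← ys ] 𝟙 (does (y ≟ x)) ≡⟨ ∑-comm xs ys _ ⟩
    ∑[ y ← ys ] occurrences y xs    ≤⟨ ∑-mono-≤ ys (λ {y} _ → occurrences-unique u y) ⟩
    ∑[ _ ← ys ] 1                   ≡⟨ ∑-count ys ⟩
    length ys                       ∎
    where open ≤-Reasoning

restrict : ∀ {n} → Subset n → Vec A n → List A
restrict []            []      = []
restrict (inside ∷ p)  (a ∷ w) = a ∷ restrict p w
restrict (outside ∷ p) (a ∷ w) = restrict p w

length-restrict : ∀ {n} (p : Subset n) (w : Vec A n) → length (restrict p w) ≡ ∣ p ∣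
length-restrict []            []      = refl
length-restrict (inside ∷ p)  (a ∷ w) = cong suc (length-restrict p w)
length-restrict (outside ∷ p) (a ∷ w) = length-restrict p w

restrict-≡⇒lookup-≡ : ∀ {n} {p : Subset n} {i} (u w : Vec A n) →
                      i ∈ p → restrict p u ≡ restrict p w → lookup u i ≡ lookup w i
restrict-≡⇒lookup-≡ {p = inside ∷ p}  (a ∷ u) (b ∷ w) here       eq = Listₚ.∷-injectiveˡ eq
restrict-≡⇒lookup-≡ {p = inside ∷ p}  (a ∷ u) (b ∷ w) (there i∈) eq = restrict-≡⇒lookup-≡ u w i∈ (Listₚ.∷-injectiveʳ eq)
restrict-≡⇒lookup-≡ {p = outside ∷ p} (a ∷ u) (b ∷ w) (there i∈) eq = restrict-≡⇒lookup-≡ u w i∈ eq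

restrict-⊆ : ∀ {n} {p r : Subset n} (u w : Vec A n) → p ⊆ r → restrict r u ≡ restrict r w → restrict p u ≡ restrict p w
restrict-⊆ {p = []}          {[]}          []      []      _   _  = refl
restrict-⊆ {p = inside ∷ p}  {outside ∷ r} _       _       p⊆r _  with () ← p⊆r here
restrict-⊆ {p = inside ∷ p}  {inside ∷ r}  (a ∷ u) (b ∷ w) p⊆r eq =
  cong₂ _∷_ (Listₚ.∷-injectiveˡ eq) (restrict-⊆ u w (drop-∷-⊆ p⊆r) (Listₚ.∷-injectiveʳ eq))
restrict-⊆ {p = outside ∷ p} {inside ∷ r}  (a ∷ u) (b ∷ w) p⊆r eq = restrict-⊆ u w (drop-∷-⊆ p⊆r) (Listₚ.∷-injectiveʳ eq)
restrict-⊆ {p = outside ∷ p} {outside ∷ r} (a ∷ u) (b ∷ w) p⊆r eq = restrict-⊆ u w (drop-∷-⊆ p⊆r) eq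

restrict-[]≔ : ∀ {n} {p : Subset n} {i} (w : Vec A n) a → i ∉ p → restrict p (w [ i ]≔ a) ≡ restrict p w
restrict-[]≔ {p = inside ∷ p}  {zero}  (b ∷ w) a i∉p = ⊥-elim (i∉p here)
restrict-[]≔ {p = outside ∷ p} {zero}  (b ∷ w) a i∉p = refl
restrict-[]≔ {p = inside ∷ p}  {suc i} (b ∷ w) a i∉p = cong (b ∷_) (restrict-[]≔ w a (i∉p ∘ there))
restrict-[]≔ {p = outside ∷ p} {suc i} (b ∷ w) a i∉p = restrict-[]≔ w a (i∉p ∘ there)

listsOfLength : ∀ q → ℕ → List (List (Fin q))
listsOfLength q zero    = [] ∷ []
listsOfLength q (suc k) = concatMap (λ a → map (a ∷_) (listsOfLength q k)) (allFin q)

length-listsOfLength : ∀ q k → length (listsOfLength q k) ≡ q ^ k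
length-listsOfLength q zero    = refl
length-listsOfLength q (suc k) = begin
  length (listsOfLength q (suc k))                          ≡⟨ length-concatMap _ (allFin q) ⟩
  ∑[ a ← allFin q ] length (map (a ∷_) (listsOfLength q k))
    ≡⟨ ∑-cong (allFin q) (λ _ → Listₚ.length-map _ (listsOfLength q k)) ⟩
  ∑[ _ ← allFin q ] length (listsOfLength q k)
    ≡⟨ ∑-const (allFin q) _ ⟩
  length (allFin q) * length (listsOfLength q k)
    ≡⟨ cong₂ _*_ (Listₚ.length-tabulate {n = q} id) (length-listsOfLength q k) ⟩
  q * q ^ k                                                 ∎
  where open ≡-Reasoning

∈-listsOfLength : ∀ {q} (l : List (Fin q)) → l ∈ˡ listsOfLength q (length l)
∈-listsOfLength []      = Any.here refl
∈-listsOfLength (a ∷ l) = ∈-concatMap⁺ _ (lose (∈-allFin a) (∈-map⁺ (a ∷_) (∈-listsOfLength l)))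

restrict-distinct⇒length≤ : ∀ {q n} (p : Subset n) {ws : List (Vec (Fin q) n)} →
                            Unique (map (restrict p) ws) → length ws ≤ q ^ ∣ p ∣
restrict-distinct⇒length≤ {q} p {ws} u = begin
  length ws                        ≡⟨ Listₚ.length-map (restrict p) ws ⟨
  length (map (restrict p) ws)     ≤⟨ unique-⊆⇒length≤ (Listₚ.≡-dec Fin._≟_) u patterns⊆ ⟩
  length (listsOfLength q ∣ p ∣)   ≡⟨ length-listsOfLength q ∣ p ∣ ⟩
  q ^ ∣ p ∣                        ∎
  where
  open ≤-Reasoning
  patterns⊆ : ∀ {l} → l ∈ˡ map (restrict p) ws → l ∈ˡ listsOfLength q ∣ p ∣
  patterns⊆ l∈ with w , _ , refl ← ∈-map⁻ (restrict p) l∈ =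
    subst (λ k → restrict p w ∈ˡ listsOfLength q k) (length-restrict p w) (∈-listsOfLength (restrict p w))

-- Covering a demand by sets of bounded size

degree : ∀ {m n} → (Fin m → Subset n) → Fin n → ℕ
degree {m} E i = ∑[ k ← allFin m ] 𝟙 (lookup (E k) i)

does≡true⇒ : ∀ {p} {P : Set p} (d : Dec P) → does d ≡ true → P
does≡true⇒ (yes p) _ = p

atLeast : ∀ {n} → ℕ → (Fin n → ℕ) → Subset n
atLeast k r = Vec.tabulate (λ i → does (k ≤? r i))

module _ {n} (r : Fin n → ℕ) where

  lookup-atLeast : ∀ k i → lookup (atLeast k r) i ≡ does (k ≤? r i)
  lookup-atLeast k = Vecₚ.lookup∘tabulate _

  ∈-atLeast⁻ : ∀ {k i} → i ∈ atLeast k r → k ≤ r i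
  ∈-atLeast⁻ {k} {i} i∈ = does≡true⇒ (k ≤? r i) (trans (sym (lookup-atLeast k i)) (Vecₚ.[]=⇒lookup i∈))

  ∈-atLeast⁺ : ∀ {k i} → k ≤ r i → i ∈ atLeast k r
  ∈-atLeast⁺ {k} {i} k≤r = Vecₚ.lookup⇒[]= i _ (trans (lookup-atLeast k i) (dec-true (k ≤? r i) k≤r))

  atLeast-anti : ∀ {j k} → j ≤ k → atLeast k r ⊆ atLeast j r
  atLeast-anti j≤k i∈ = ∈-atLeast⁺ (≤-trans j≤k (∈-atLeast⁻ i∈))

  *-∣atLeast∣≤∑ : ∀ k → k * ∣ atLeast k r ∣ ≤ ∑[ i ← allFin n ] r i
  *-∣atLeast∣≤∑ k = begin
    k * ∣ atLeast k r ∣                                 ≡⟨ cong (k *_) (∣p∣≡∑𝟙 (atLeast k r)) ⟩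
    k * ∑[ i ← allFin n ] 𝟙 (lookup (atLeast k r) i)    ≡⟨ ∑-*-distribˡ (allFin n) k _ ⟨
    ∑[ i ← allFin n ] (k * 𝟙 (lookup (atLeast k r) i))  ≤⟨ ∑-mono-≤ (allFin n) (λ {i} _ → pointwise i) ⟩
    ∑[ i ← allFin n ] r i                               ∎
    where
    open ≤-Reasoning
    pointwise : ∀ i → k * 𝟙 (lookup (atLeast k r) i) ≤ r i
    pointwise i with lookup (atLeast k r) i in eq
    ... | inside  = ≤-trans (≤-reflexive (*-identityʳ k)) (∈-atLeast⁻ (Vecₚ.lookup⇒[]= i _ eq))
    ... | outside = ≤-trans (≤-reflexive (*-zeroʳ k)) z≤n

  ∣atLeast∣≤ : ∀ k .{{_ : NonZero k}} {h} → ∑[ i ← allFin n ] r i ≤ k * h → ∣ atLeast k r ∣ ≤ h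
  ∣atLeast∣≤ k ∑r≤ = *-cancelˡ-≤ k (≤-trans (*-∣atLeast∣≤∑ k) ∑r≤)

  ∑≤*-∣atLeast1∣ : ∀ m → (∀ i → r i ≤ m) → ∑[ i ← allFin n ] r i ≤ m * ∣ atLeast 1 r ∣
  ∑≤*-∣atLeast1∣ m r≤m = begin
    ∑[ i ← allFin n ] r i                               ≤⟨ ∑-mono-≤ (allFin n) (λ {i} _ → pointwise i) ⟩
    ∑[ i ← allFin n ] (m * 𝟙 (lookup (atLeast 1 r) i))  ≡⟨ ∑-*-distribˡ (allFin n) m _ ⟩
    m * ∑[ i ← allFin n ] 𝟙 (lookup (atLeast 1 r) i)    ≡⟨ cong (m *_) (∣p∣≡∑𝟙 (atLeast 1 r)) ⟨
    m * ∣ atLeast 1 r ∣                                 ∎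
    where
    open ≤-Reasoning
    pointwise : ∀ i → r i ≤ m * 𝟙 (lookup (atLeast 1 r) i)
    pointwise i with lookup (atLeast 1 r) i in eq
    ... | inside  = ≤-trans (r≤m i) (≤-reflexive (sym (*-identityʳ m)))
    ... | outside = ≤-trans (≤-reflexive (n<1⇒n≡0 (≰⇒> (lookup≡outside⇒∉ eq ∘ ∈-atLeast⁺)))) z≤n

private
  first-cover-set : ∀ m h {n} (r : Fin n → ℕ) → (∀ i → r i ≤ suc m) → ∑[ i ← allFin n ] r i ≤ suc m * h →
    ∃ λ E₀ → atLeast (suc m) r ⊆ E₀ × E₀ ⊆ atLeast 1 r × ∣ E₀ ∣ ≤ h × ∑[ i ← allFin n ] r i ≤ ∣ E₀ ∣ + m * h
  first-cover-set m h r r≤1+m ∑r≤ with ≤-total h ∣ atLeast 1 r ∣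
  ... | inj₁ h≤∣pos∣
    with E₀ , sat⊆E₀ , E₀⊆pos , ∣E₀∣≡h ← ⊆-between h (atLeast-anti r (s≤s z≤n)) (∣atLeast∣≤ r (suc m) ∑r≤) h≤∣pos∣
    = E₀ , sat⊆E₀ , E₀⊆pos , ≤-reflexive ∣E₀∣≡h , subst (λ k → _ ≤ k + m * h) (sym ∣E₀∣≡h) ∑r≤
  ... | inj₂ ∣pos∣≤h = atLeast 1 r , atLeast-anti r (s≤s z≤n) , ⊆-refl , ∣pos∣≤h ,
    ≤-trans (∑≤*-∣atLeast1∣ r (suc m) r≤1+m) (+-monoʳ-≤ ∣ atLeast 1 r ∣ (*-monoʳ-≤ m ∣pos∣≤h))

BoundedCover : ∀ m h {n} → (Fin n → ℕ) → Set
BoundedCover m h {n} r = ∃ λ (E : Fin m → Subset n) → (∀ k → ∣ E k ∣ ≤ h) × (∀ i → r i ≤ degree E i)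

-- Induction on m: the first set takes every coordinate still demanding m + 1 sets (at most h of
-- them, the total demand being at most (m + 1) h) and fills up with coordinates of positive
-- demand; the remaining demand is at most m everywhere and at most m h in total.
bounded-cover : ∀ m h {n} (r : Fin n → ℕ) → (∀ i → r i ≤ m) → ∑[ i ← allFin n ] r i ≤ m * h → BoundedCover m h r
bounded-cover zero    h r r≤0 _ = (λ ()) , (λ ()) , r≤0
bounded-cover (suc m) h {n} r r≤1+m ∑r≤
  with E₀ , sat⊆E₀ , E₀⊆pos , ∣E₀∣≤h , ∑r≤∣E₀∣+ ← first-cover-set m h r r≤1+m ∑r≤
  = extend (bounded-cover m h r′ r′≤m ∑r′≤)
  where
  r′ : Fin n → ℕ
  r′ i = r i ∸ 𝟙 (lookup E₀ i)

  𝟙≤r : ∀ i → 𝟙 (lookup E₀ i) ≤ r i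
  𝟙≤r i with lookup E₀ i in eq
  ... | inside  = ∈-atLeast⁻ r (E₀⊆pos (Vecₚ.lookup⇒[]= i E₀ eq))
  ... | outside = z≤n

  r′≤m : ∀ i → r′ i ≤ m
  r′≤m i with lookup E₀ i in eq
  ... | inside  = ∸-monoˡ-≤ 1 (r≤1+m i)
  ... | outside = ≤-pred (≰⇒> (lookup≡outside⇒∉ eq ∘ sat⊆E₀ ∘ ∈-atLeast⁺ r))

  ∑r′≤ : ∑[ i ← allFin n ] r′ i ≤ m * h
  ∑r′≤ = +-cancelʳ-≤ ∣ E₀ ∣ _ _ (begin
    ∑[ i ← allFin n ] r′ i + ∣ E₀ ∣                            ≡⟨ cong (∑ (allFin n) r′ +_) (∣p∣≡∑𝟙 E₀) ⟩
    ∑[ i ← allFin n ] r′ i + ∑[ i ← allFin n ] 𝟙 (lookup E₀ i) ≡⟨ ∑-∸ (allFin n) (λ {i} _ → 𝟙≤r i) ⟩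
    ∑[ i ← allFin n ] r i                                      ≤⟨ ∑r≤∣E₀∣+ ⟩
    ∣ E₀ ∣ + m * h                                             ≡⟨ +-comm ∣ E₀ ∣ (m * h) ⟩
    m * h + ∣ E₀ ∣                                             ∎)
    where open ≤-Reasoning

  extend : BoundedCover m h r′ → BoundedCover (suc m) h r
  extend (E , ∣E∣≤h , r′≤deg) = E₀ Vector.∷ E , (λ { zero → ∣E₀∣≤h ; (suc k) → ∣E∣≤h k }) , r≤deg
    where
    r≤deg : ∀ i → r i ≤ degree (E₀ Vector.∷ E) i
    r≤deg i = begin
      r i                             ≤⟨ m≤n+m∸n (r i) (𝟙 (lookup E₀ i)) ⟩
      𝟙 (lookup E₀ i) + r′ i          ≤⟨ +-monoʳ-≤ (𝟙 (lookup E₀ i)) (r′≤deg i) ⟩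
      𝟙 (lookup E₀ i) + degree E i    ≡⟨ ∑-allFin-suc (λ k → 𝟙 (lookup ((E₀ Vector.∷ E) k) i)) ⟨
      degree (E₀ Vector.∷ E) i        ∎
      where open ≤-Reasoning

-- Degrees of disjoint sequences

column : ∀ {m n} → (Fin m → Subset n) → Fin n → Subset m
column A i = Vec.tabulate (λ j → lookup (A j) i)

module _ {m n} (A : Fin m → Subset n) where

  lookup-column : ∀ i j → lookup (column A i) j ≡ lookup (A j) i
  lookup-column i = Vecₚ.lookup∘tabulate _

  ∈-column⁺ : ∀ {i j} → i ∈ A j → j ∈ column A i
  ∈-column⁺ {i} {j} i∈ = Vecₚ.lookup⇒[]= j _ (trans (lookup-column i j) (Vecₚ.[]=⇒lookup i∈))

  ∈-column⁻ : ∀ {i j} → j ∈ column A i → i ∈ A j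
  ∈-column⁻ {i} {j} j∈ = Vecₚ.lookup⇒[]= i _ (trans (sym (lookup-column i j)) (Vecₚ.[]=⇒lookup j∈))

  ∣column∣≡degree : ∀ i → ∣ column A i ∣ ≡ degree A i
  ∣column∣≡degree i = trans (∣p∣≡∑𝟙 (column A i)) (∑-cong (allFin m) (λ {j} _ → cong 𝟙 (lookup-column i j)))

  ∑-degree : ∑[ i ← allFin n ] degree A i ≡ ∑[ j ← allFin m ] ∣ A j ∣
  ∑-degree = trans (∑-comm (allFin n) (allFin m) _) (∑-cong (allFin m) (λ {j} _ → sym (∣p∣≡∑𝟙 (A j))))

  k≤∣∁column∣ : ∀ {k} i → degree A i + k ≤ m → k ≤ ∣ ∁ (column A i) ∣
  k≤∣∁column∣ {k} i deg+k≤m = begin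
    k                               ≡⟨ m+n∸m≡n (degree A i) k ⟨
    degree A i + k ∸ degree A i     ≤⟨ ∸-monoˡ-≤ (degree A i) deg+k≤m ⟩
    m ∸ degree A i                  ≡⟨ cong (m ∸_) (∣column∣≡degree i) ⟨
    m ∸ ∣ column A i ∣              ≡⟨ ∣∁p∣≡n∸∣p∣ (column A i) ⟨
    ∣ ∁ (column A i) ∣              ∎
    where open ≤-Reasoning

  module _ {k₁ k₂} (disjoint : IsDisjointSeq k₁ k₂ A) where

    disjointSeq⇒degree<k₁ : ∀ i → degree A i < k₁
    disjointSeq⇒degree<k₁ i with k₁ ≤? degree A i
    ... | no  k₁≰deg = ≰⇒> k₁≰deg
    ... | yes k₁≤deg
      with B , B⊆col , ∣B∣≡k₁ ← ⊆-choose k₁ (≤-trans k₁≤deg (≤-reflexive (sym (∣column∣≡degree i))))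
      = ⊥-elim (proj₁ disjoint B ∣B∣≡k₁ i (λ j j∈B → ∈-column⁻ (B⊆col j∈B)))

    disjointSeq⇒m<degree+k₂ : ∀ i → m < degree A i + k₂
    disjointSeq⇒m<degree+k₂ i with degree A i + k₂ ≤? m
    ... | no  ≰m = ≰⇒> ≰m
    ... | yes deg+k₂≤m
      with B , B⊆∁col , ∣B∣≡k₂ ← ⊆-choose k₂ (k≤∣∁column∣ i deg+k₂≤m)
      with j , j∈B , i∈Aj ← proj₂ disjoint B ∣B∣≡k₂ i
      = ⊥-elim (x∈∁p⇒x∉p (B⊆∁col j∈B) (∈-column⁺ i∈Aj))

degree-++ : ∀ {m k n} (A : Fin m → Subset n) (E : Fin k → Subset n) i →
            degree (A Vector.++ E) i ≡ degree A i + degree E i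
degree-++ {m} {k} A E i = begin
  degree (A Vector.++ E) i
    ≡⟨ ∑-allFin-+ m _ ⟩
  ∑[ j ← allFin m ] 𝟙 (lookup ((A Vector.++ E) (j ↑ˡ k)) i) + ∑[ j ← allFin k ] 𝟙 (lookup ((A Vector.++ E) (m ↑ʳ j)) i)
    ≡⟨ cong₂ _+_ (∑-cong (allFin m) λ {j} _ → cong (λ p → 𝟙 (lookup p i)) (Vectorₚ.lookup-++ˡ A E j))
                 (∑-cong (allFin k) λ {j} _ → cong (λ p → 𝟙 (lookup p i)) (Vectorₚ.lookup-++ʳ A E j)) ⟩
  degree A i + degree E i
    ∎
  where open ≡-Reasoning

-- Identifying sets

module _ {q n} (𝒞 : Code q n) where

  Identifies : Subset n → Word q n → Set
  Identifies p x = All (λ y → restrict p y ≡ restrict p x → y ≡ x) (words 𝒞)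

  Confusable : Subset n → Word q n → Set
  Confusable p x = ∃ λ y → y ∈ˡ words 𝒞 × x ≢ y × restrict p y ≡ restrict p x

  private
    _≟ᴾ_ : DecidableEquality (List (Fin q))
    _≟ᴾ_ = Listₚ.≡-dec Fin._≟_

    _≟ᵂ_ : DecidableEquality (Word q n)
    _≟ᵂ_ = Vecₚ.≡-dec Fin._≟_

  identifies? : ∀ p x → Dec (Identifies p x)
  identifies? p x = All.all? (λ y → (restrict p y ≟ᴾ restrict p x) →-dec (y ≟ᵂ x)) (words 𝒞)

  ¬identifies⇒confusable : ∀ {p x} → ¬ Identifies p x → Confusable p x
  ¬identifies⇒confusable {p} {x} ¬id
    with y , y∈ , ¬[≡⇒≡] ← find (¬All⇒Any¬ (λ y → (restrict p y ≟ᴾ restrict p x) →-dec (y ≟ᵂ x)) (words 𝒞) ¬id)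
    with restrict p y ≟ᴾ restrict p x
  ... | yes same = y , y∈ , (λ x≡y → ¬[≡⇒≡] (λ _ → sym x≡y)) , same
  ... | no  diff = ⊥-elim (¬[≡⇒≡] (⊥-elim ∘ diff))

  confusable-⊆ : ∀ {p r x} → p ⊆ r → Confusable r x → Confusable p x
  confusable-⊆ p⊆r (y , y∈ , x≢y , same) = y , y∈ , x≢y , restrict-⊆ y _ p⊆r same

  degree≤agreeCount : ∀ {c} {x} (B : Fin c → Subset n) (conf : ∀ j → Confusable (B j) x) i →
                      degree B i ≤ agreeCount (λ j → proj₁ (conf j)) x i
  degree≤agreeCount {c} {x} B conf i = begin
    degree B i                                      ≤⟨ ∑-mono-≤ (allFin c) (λ {j} _ → pointwise j) ⟩
    ∑[ j ← allFin c ] 𝟙 (does (lookup (ys j) i Fin.≟ lookup x i)) ≡⟨ length-filter≡∑ _ (allFin c) ⟨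
    agreeCount ys x i                               ∎
    where
    open ≤-Reasoning
    ys : Fin c → Word q n
    ys j = proj₁ (conf j)
    pointwise : ∀ j → 𝟙 (lookup (B j) i) ≤ 𝟙 (does (lookup (ys j) i Fin.≟ lookup x i))
    pointwise j with lookup (B j) i in eq
    ... | outside = z≤n
    ... | inside  = ≤-reflexive (sym (cong 𝟙 (dec-true (_ Fin.≟ _)
                      (restrict-≡⇒lookup-≡ (ys j) x (Vecₚ.lookup⇒[]= i (B j) eq) (proj₂ (proj₂ (proj₂ (conf j))))))))

  frameproof⇒¬confusable-cover : ∀ {c s x} → IsFrameproof c s 𝒞 → x ∈ˡ words 𝒞 →
    (B : Fin c → Subset n) → (∀ j → Confusable (B j) x) → ¬ (∀ i → s ≤ degree B i)
  frameproof⇒¬confusable-cover fp x∈ B conf s≤deg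
    with i , few ← fp _ (λ j → proj₁ (conf j)) x∈ (λ j → proj₁ (proj₂ (conf j))) (λ j → proj₁ (proj₂ (proj₂ (conf j))))
    = <⇒≱ few (≤-trans (s≤deg i) (degree≤agreeCount B conf i))

  frameproof⇒¬confusable-disjointSeq :
    ∀ {λ′ m s t x} → IsFrameproof (λ′ + m) s 𝒞 → s ≤ λ′ + m → s * n ≤ λ′ * t + m * (t ∸ 1) →
    x ∈ˡ words 𝒞 → (∀ p → ∣ p ∣ ≤ t ∸ 1 → Confusable p x) →
    (A : Fin λ′ → Subset n) → (∀ j → ∣ A j ∣ ≡ t) → (∀ j → Confusable (A j) x) →
    ¬ IsDisjointSeq (s + 1) (λ′ + m ∸ s + 1) A
  frameproof⇒¬confusable-disjointSeq {λ′} {m} {s} {t} {x} fp s≤λ′+m sn≤ x∈ small-conf A ∣A∣≡t A-conf disjoint =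
    uncovered (bounded-cover m (t ∸ 1) r r≤m ∑r≤)
    where
    d : Fin n → ℕ
    d = degree A

    d≤s : ∀ i → d i ≤ s
    d≤s i = m<1+n⇒m≤n (subst (d i <_) (+-comm s 1) (disjointSeq⇒degree<k₁ A disjoint i))

    λ′≤d+[λ′+m∸s] : ∀ i → λ′ ≤ d i + (λ′ + m ∸ s)
    λ′≤d+[λ′+m∸s] i = m<1+n⇒m≤n (subst (λ′ <_) (trans (cong (d i +_) (+-comm _ 1)) (+-suc (d i) _))
                                      (disjointSeq⇒m<degree+k₂ A disjoint i))

    s≤d+m : ∀ i → s ≤ d i + m
    s≤d+m i = +-cancelˡ-≤ λ′ s (d i + m) (begin
      λ′ + s                        ≤⟨ +-monoˡ-≤ s (λ′≤d+[λ′+m∸s] i) ⟩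
      d i + (λ′ + m ∸ s) + s        ≡⟨ +-assoc (d i) _ s ⟩
      d i + (λ′ + m ∸ s + s)        ≡⟨ cong (d i +_) (m∸n+n≡m s≤λ′+m) ⟩
      d i + (λ′ + m)                ≡⟨ x+[y+z]≡y+[x+z] (d i) λ′ m ⟩
      λ′ + (d i + m)                ∎)
      where open ≤-Reasoning

    r : Fin n → ℕ
    r i = s ∸ d i

    r≤m : ∀ i → r i ≤ m
    r≤m i = m≤n+o⇒m∸n≤o s (d i) (s≤d+m i)

    ∑r≤ : ∑[ i ← allFin n ] r i ≤ m * (t ∸ 1)
    ∑r≤ = +-cancelʳ-≤ (λ′ * t) _ _ (begin
      ∑[ i ← allFin n ] r i + λ′ * t    ≡⟨ cong (∑ (allFin n) r +_) ∑d≡λ′t ⟨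
      ∑[ i ← allFin n ] r i + ∑ (allFin n) d ≡⟨ ∑-∸ (allFin n) (λ {i} _ → d≤s i) ⟩
      ∑[ _ ← allFin n ] s               ≡⟨ ∑-const (allFin n) s ⟩
      length (allFin n) * s            ≡⟨ cong (_* s) (Listₚ.length-tabulate {n = n} id) ⟩
      n * s                            ≡⟨ *-comm n s ⟩
      s * n                            ≤⟨ sn≤ ⟩
      λ′ * t + m * (t ∸ 1)              ≡⟨ +-comm (λ′ * t) _ ⟩
      m * (t ∸ 1) + λ′ * t              ∎)
      where
      open ≤-Reasoning
      ∑d≡λ′t : ∑ (allFin n) d ≡ λ′ * t
      ∑d≡λ′t = begin-equality
        ∑ (allFin n) d                 ≡⟨ ∑-degree A ⟩
        ∑[ j ← allFin λ′ ] ∣ A j ∣      ≡⟨ ∑-cong (allFin λ′) (λ {j} _ → ∣A∣≡t j) ⟩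
        ∑[ _ ← allFin λ′ ] t            ≡⟨ ∑-const (allFin λ′) t ⟩
        length (allFin λ′) * t          ≡⟨ cong (_* t) (Listₚ.length-tabulate {n = λ′} id) ⟩
        λ′ * t                          ∎

    uncovered : BoundedCover m (t ∸ 1) r → ⊥
    uncovered (E , ∣E∣≤ , r≤degE) =
      frameproof⇒¬confusable-cover fp x∈ (A Vector.++ E)
        (VectorAllₚ.++⁺ (λ p → Confusable p x) A-conf (λ k → small-conf (E k) (∣E∣≤ k))) s≤degree
      where
      s≤degree : ∀ i → s ≤ degree (A Vector.++ E) i
      s≤degree i = begin
        s                              ≤⟨ m≤n+m∸n s (d i) ⟩
        d i + r i                      ≤⟨ +-monoʳ-≤ (d i) (r≤degE i) ⟩
        d i + degree E i               ≡⟨ degree-++ A E i ⟨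
        degree (A Vector.++ E) i       ∎
        where open ≤-Reasoning

-- Weighted claims

module WeightedClaims {q n} (𝒞 : Code q n) (t : ℕ) where

  private
    _≟ˢ_ : DecidableEquality (Subset n)
    _≟ˢ_ = Vecₚ.≡-dec Boolₚ._≟_

  chosen : Word q n → Maybe (Subset n)
  chosen x = List.find (λ S → identifies? 𝒞 S x) (subsetsOfSize n (t ∸ 1))

  -- Given j ∈ T, the condition S ≡ T [ j ]≔ outside says T = S ∪ {j}.
  claim : Maybe (Subset n) → Word q n → Subset n → Fin n → ℕ
  claim (just S) x T j = q * 𝟙 (does (S ≟ˢ (T [ j ]≔ outside)))
  claim nothing  x T j = 𝟙 (does (identifies? 𝒞 T x))

  weight : Word q n → Subset n → Fin n → ℕ
  weight x T j = 𝟙 (lookup T j) * claim (chosen x) x T j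

  totalWeight : Word q n → ℕ
  totalWeight x = ∑[ T ← subsetsOfSize n t ] ∑[ j ← allFin n ] weight x T j

  chosen≡just⇒q*[n∸[t∸1]]≤totalWeight : ∀ {x S} → 1 ≤ t → chosen x ≡ just S → q * (n ∸ (t ∸ 1)) ≤ totalWeight x
  chosen≡just⇒q*[n∸[t∸1]]≤totalWeight {x} {S} 1≤t chosen≡S = begin
    q * (n ∸ (t ∸ 1))                            ≡⟨ cong (λ k → q * (n ∸ k)) ∣S∣≡t∸1 ⟨
    q * (n ∸ ∣ S ∣)                              ≡⟨ cong (q *_) (∑𝟙∁≡n∸∣p∣ S) ⟨
    q * ∑[ j ← allFin n ] 𝟙 (not (lookup S j))   ≡⟨ ∑-*-distribˡ (allFin n) q _ ⟨
    ∑[ j ← allFin n ] (q * 𝟙 (not (lookup S j))) ≤⟨ ∑-mono-≤ (allFin n) (λ {j} _ → extension-claimed j) ⟩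
    ∑[ j ← allFin n ] ∑[ T ← Ts ] weight x T j   ≡⟨ ∑-comm Ts (allFin n) (weight x) ⟨
    totalWeight x                                ∎
    where
    open ≤-Reasoning
    Ts = subsetsOfSize n t
    ∣S∣≡t∸1 : ∣ S ∣ ≡ t ∸ 1
    ∣S∣≡t∸1 = ∈-subsetsOfSize⁻ n (t ∸ 1) (proj₂ (find-just _ (subsetsOfSize n (t ∸ 1)) chosen≡S))
    extension-claimed : ∀ j → q * 𝟙 (not (lookup S j)) ≤ ∑[ T ← Ts ] weight x T j
    extension-claimed j with lookup S j in eq
    ... | inside  = ≤-trans (≤-reflexive (*-zeroʳ q)) z≤n
    ... | outside = ≤-trans (≤-reflexive weight≡q) (∈⇒≤∑ (λ T → weight x T j) T∈Ts)
      where
      j∉S : j ∉ S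
      j∉S = lookup≡outside⇒∉ eq
      T : Subset n
      T = S [ j ]≔ inside
      T∈Ts : T ∈ˡ Ts
      T∈Ts = ∈-subsetsOfSize⁺ n t T (trans (∣p[i]≔inside∣ j∉S) (trans (cong suc ∣S∣≡t∸1) (m+[n∸m]≡n 1≤t)))
      weight≡q : q * 𝟙 true ≡ weight x T j
      weight≡q rewrite chosen≡S | Vecₚ.lookup∘update j S inside | p[i]≔inside[i]≔outside j∉S
                     | dec-true (S ≟ˢ S) refl = sym (+-identityʳ (q * 1))

  chosen≡nothing⇒totalWeight≡ : ∀ {x} → chosen x ≡ nothing →
    totalWeight x ≡ t * length (filter (λ T → identifies? 𝒞 T x) (subsetsOfSize n t))
  chosen≡nothing⇒totalWeight≡ {x} chosen≡nothing = begin
    totalWeight x                                ≡⟨ ∑-cong Ts (λ T∈ → claimed-sum T∈) ⟩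
    ∑[ T ← Ts ] (t * 𝟙 (does (identifies? 𝒞 T x))) ≡⟨ ∑-*-distribˡ Ts t _ ⟩
    t * ∑[ T ← Ts ] 𝟙 (does (identifies? 𝒞 T x))   ≡⟨ cong (t *_) (length-filter≡∑ _ Ts) ⟨
    t * length (filter (λ T → identifies? 𝒞 T x) Ts) ∎
    where
    open ≡-Reasoning
    Ts = subsetsOfSize n t
    claimed-sum : ∀ {T} → T ∈ˡ Ts → ∑[ j ← allFin n ] weight x T j ≡ t * 𝟙 (does (identifies? 𝒞 T x))
    claimed-sum {T} T∈ rewrite chosen≡nothing = begin
      ∑[ j ← allFin n ] (𝟙 (lookup T j) * k)   ≡⟨ ∑-cong (allFin n) (λ {j} _ → *-comm (𝟙 (lookup T j)) k) ⟩
      ∑[ j ← allFin n ] (k * 𝟙 (lookup T j))   ≡⟨ ∑-*-distribˡ (allFin n) k _ ⟩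
      k * ∑[ j ← allFin n ] 𝟙 (lookup T j)     ≡⟨ cong (k *_) (trans (sym (∈-subsetsOfSize⁻ n t T∈)) (∣p∣≡∑𝟙 T)) ⟨
      k * t                                    ≡⟨ *-comm k t ⟩
      t * k                                    ∎
      where k = 𝟙 (does (identifies? 𝒞 T x))

  module _ (T : Subset n) {j : Fin n} (j∈T : j ∈ T) where

    private
      S : Subset n
      S = T [ j ]≔ outside

      _≟ᵐ_ : DecidableEquality (Maybe (Subset n))
      _≟ᵐ_ = Maybeₚ.≡-dec _≟ˢ_

      X? : Decidable (λ x → chosen x ≡ just S)
      X? x = chosen x ≟ᵐ just S

      Y? : Decidable (λ x → chosen x ≡ nothing × Identifies 𝒞 T x)
      Y? x = (chosen x ≟ᵐ nothing) ×-dec identifies? 𝒞 T x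

      X Y : List (Word q n)
      X = filter X? (words 𝒞)
      Y = filter Y? (words 𝒞)

      variants : Word q n → List (Word q n)
      variants x = tabulate (λ v → x [ j ]≔ v)

      Distinct : Word q n → Word q n → Set
      Distinct u w = restrict T u ≢ restrict T w

      restrictS-variant : ∀ {x u : Word q n} → u ∈ˡ variants x → restrict S u ≡ restrict S x
      restrictS-variant u∈ with v , refl ← ∈-tabulate⁻ u∈ = restrict-[]≔ _ v (i∉p[i]≔outside T j)

      restrictT⇒restrictS : ∀ {u w : Word q n} → restrict T u ≡ restrict T w → restrict S u ≡ restrict S w
      restrictT⇒restrictS {u} {w} = restrict-⊆ u w (p[i]≔outside⊆p T j)

      S-identifies : ∀ {x} → x ∈ˡ X → x ∈ˡ words 𝒞 × Identifies 𝒞 S x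
      S-identifies {x} x∈ with x∈𝒞 , chosen≡S ← ∈-filter⁻ X? {xs = words 𝒞} x∈ =
        x∈𝒞 , proj₁ (find-just (λ S → identifies? 𝒞 S x) (subsetsOfSize n (t ∸ 1)) chosen≡S)

      variants-distinct : ∀ x → AllPairs Distinct (variants x)
      variants-distinct x = AllPairsₚ.tabulate⁺ λ {v} {v′} v≢v′ same → v≢v′ (begin
        v                         ≡⟨ Vecₚ.lookup∘update j x v ⟨
        lookup (x [ j ]≔ v) j     ≡⟨ restrict-≡⇒lookup-≡ _ _ j∈T same ⟩
        lookup (x [ j ]≔ v′) j    ≡⟨ Vecₚ.lookup∘update j x v′ ⟩
        v′                        ∎)
        where open ≡-Reasoning

      variants-disjoint : ∀ {x x′} → x ∈ˡ X → x′ ∈ˡ X → x ≢ x′ →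
                          All (λ u → All (Distinct u) (variants x′)) (variants x)
      variants-disjoint x∈ x′∈ x≢x′ = All.tabulate λ u∈ → All.tabulate λ u′∈ same →
        x≢x′ (All.lookup (proj₂ (S-identifies x′∈)) (proj₁ (S-identifies x∈)) (begin
          restrict S _ ≡⟨ restrictS-variant u∈ ⟨
          restrict S _ ≡⟨ restrictT⇒restrictS same ⟩
          restrict S _ ≡⟨ restrictS-variant u′∈ ⟩
          restrict S _ ∎))
        where open ≡-Reasoning

      X-Y-disjoint : ∀ {x y} → x ∈ˡ X → y ∈ˡ Y → y ≢ x
      X-Y-disjoint x∈X y∈Y refl
        with () ← trans (sym (proj₁ (proj₂ (∈-filter⁻ Y? {xs = words 𝒞} y∈Y)))) (proj₂ (∈-filter⁻ X? {xs = words 𝒞} x∈X))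

      variants-Y-disjoint : ∀ {u} → u ∈ˡ concatMap variants X → All (Distinct u) Y
      variants-Y-disjoint u∈ with x , x∈X , u∈variants ← find (∈-concatMap⁻ variants u∈) =
        All.tabulate λ y∈Y same → X-Y-disjoint x∈X y∈Y
          (All.lookup (proj₂ (S-identifies x∈X)) (proj₁ (∈-filter⁻ Y? {xs = words 𝒞} y∈Y))
                      (sym (trans (sym (restrictS-variant u∈variants)) (restrictT⇒restrictS same))))

      Y-distinct : AllPairs Distinct Y
      Y-distinct = AllPairs-mapWith∈ (λ y∈ y′∈ y≢y′ same →
        y≢y′ (sym (All.lookup (proj₂ (proj₂ (∈-filter⁻ Y? {xs = words 𝒞} y∈)))
                              (proj₁ (∈-filter⁻ Y? {xs = words 𝒞} y′∈)) (sym same))))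
        (AllPairsₚ.filter⁺ Y? (unique 𝒞))

      claimed-patterns-distinct : AllPairs Distinct (concatMap variants X ++ Y)
      claimed-patterns-distinct = AllPairsₚ.++⁺
        (AllPairsₚ.concat⁺ (Allₚ.map⁺ (All.universal variants-distinct X))
                           (AllPairsₚ.map⁺ (AllPairs-mapWith∈ variants-disjoint (AllPairsₚ.filter⁺ X? (unique 𝒞)))))
        Y-distinct
        (All.tabulate variants-Y-disjoint)

    claims≤q^∣T∣ : ∑[ x ← words 𝒞 ] claim (chosen x) x T j ≤ q ^ ∣ T ∣
    claims≤q^∣T∣ = begin
      ∑[ x ← words 𝒞 ] claim (chosen x) x T j                           ≡⟨ ∑-cong (words 𝒞) (λ {x} _ → claim-split x) ⟩
      ∑[ x ← words 𝒞 ] (q * 𝟙 (does (X? x)) + 𝟙 (does (Y? x)))          ≡⟨ ∑-distrib-+ (words 𝒞) _ _ ⟩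
      ∑[ x ← words 𝒞 ] (q * 𝟙 (does (X? x))) + ∑[ x ← words 𝒞 ] 𝟙 (does (Y? x))
        ≡⟨ cong₂ _+_ (trans (∑-*-distribˡ (words 𝒞) q _) (cong (q *_) (sym (length-filter≡∑ X? (words 𝒞)))))
                     (sym (length-filter≡∑ Y? (words 𝒞))) ⟩
      q * length X + length Y                                           ≡⟨ length-claimed ⟨
      length (concatMap variants X ++ Y)
        ≤⟨ restrict-distinct⇒length≤ T (AllPairsₚ.map⁺ claimed-patterns-distinct) ⟩
      q ^ ∣ T ∣                                                         ∎
      where
      open ≤-Reasoning
      claim-split : ∀ x → claim (chosen x) x T j ≡ q * 𝟙 (does (X? x)) + 𝟙 (does (Y? x))
      claim-split x = by-cases (chosen x)
        where
        by-cases : ∀ c → claim c x T j ≡ q * 𝟙 (does (c ≟ᵐ just S)) + 𝟙 (does ((c ≟ᵐ nothing) ×-dec identifies? 𝒞 T x))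
        by-cases nothing   = cong (_+ 𝟙 (does (identifies? 𝒞 T x))) (sym (*-zeroʳ q))
        by-cases (just S′) = sym (+-identityʳ _)

      length-claimed : length (concatMap variants X ++ Y) ≡ q * length X + length Y
      length-claimed = begin-equality
        length (concatMap variants X ++ Y)         ≡⟨ Listₚ.length-++ (concatMap variants X) ⟩
        length (concatMap variants X) + length Y   ≡⟨ cong (_+ length Y) (length-concatMap variants X) ⟩
        ∑[ x ← X ] length (variants x) + length Y  ≡⟨ cong (_+ length Y) (∑-cong X (λ _ → Listₚ.length-tabulate _)) ⟩
        ∑[ _ ← X ] q + length Y                    ≡⟨ cong (_+ length Y) (∑-const X q) ⟩
        length X * q + length Y                    ≡⟨ cong (_+ length Y) (*-comm (length X) q) ⟩
        q * length X + length Y                    ∎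

  weights-at≤ : ∀ T j → ∑[ x ← words 𝒞 ] weight x T j ≤ 𝟙 (lookup T j) * q ^ ∣ T ∣
  weights-at≤ T j with lookup T j in eq
  ... | outside = ≤-reflexive (trans (∑-const (words 𝒞) 0) (*-zeroʳ (length (words 𝒞))))
  ... | inside  = begin
    ∑[ x ← words 𝒞 ] (1 * claim (chosen x) x T j) ≡⟨ ∑-cong (words 𝒞) (λ _ → *-identityˡ _) ⟩
    ∑[ x ← words 𝒞 ] claim (chosen x) x T j       ≤⟨ claims≤q^∣T∣ T (Vecₚ.lookup⇒[]= j T eq) ⟩
    q ^ ∣ T ∣                                     ≡⟨ *-identityˡ (q ^ ∣ T ∣) ⟨
    1 * q ^ ∣ T ∣                                 ∎
    where open ≤-Reasoning

  ∑-totalWeight≤ : ∑[ x ← words 𝒞 ] totalWeight x ≤ (n C t) * (t * q ^ t)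
  ∑-totalWeight≤ = begin
    ∑[ x ← words 𝒞 ] totalWeight x                               ≡⟨ ∑-comm (words 𝒞) Ts _ ⟩
    ∑[ T ← Ts ] ∑[ x ← words 𝒞 ] ∑[ j ← allFin n ] weight x T j  ≤⟨ ∑-mono-≤ Ts (λ T∈ → size-t T∈) ⟩
    ∑[ _ ← Ts ] (t * q ^ t)                                      ≡⟨ ∑-const Ts _ ⟩
    length Ts * (t * q ^ t)                                      ≡⟨ cong (_* (t * q ^ t)) (length-subsetsOfSize n t) ⟩
    (n C t) * (t * q ^ t)                                        ∎
    where
    open ≤-Reasoning
    Ts = subsetsOfSize n t
    size-t : ∀ {T} → T ∈ˡ Ts → ∑[ x ← words 𝒞 ] ∑[ j ← allFin n ] weight x T j ≤ t * q ^ t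
    size-t {T} T∈ = begin
      ∑[ x ← words 𝒞 ] ∑[ j ← allFin n ] weight x T j   ≡⟨ ∑-comm (words 𝒞) (allFin n) _ ⟩
      ∑[ j ← allFin n ] ∑[ x ← words 𝒞 ] weight x T j   ≤⟨ ∑-mono-≤ (allFin n) (λ {j} _ → weights-at≤ T j) ⟩
      ∑[ j ← allFin n ] (𝟙 (lookup T j) * q ^ ∣ T ∣)     ≡⟨ ∑-*-distribʳ (allFin n) _ (q ^ ∣ T ∣) ⟩
      (∑[ j ← allFin n ] 𝟙 (lookup T j)) * q ^ ∣ T ∣     ≡⟨ cong₂ (λ a b → a * q ^ b) (sym (∣p∣≡∑𝟙 T)) ∣T∣≡t ⟩
      ∣ T ∣ * q ^ t                                      ≡⟨ cong (_* q ^ t) ∣T∣≡t ⟩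
      t * q ^ t                                         ∎
      where
      ∣T∣≡t : ∣ T ∣ ≡ t
      ∣T∣≡t = ∈-subsetsOfSize⁻ n t T∈


-- Ceilings and residues

m∸n+1≡m∸[n∸1] : ∀ {m n} → 1 ≤ n → n ≤ m → m ∸ n + 1 ≡ m ∸ (n ∸ 1)
m∸n+1≡m∸[n∸1] {m} {suc n} _ n<m = trans (+-comm (m ∸ suc n) 1) (sym (+-∸-assoc 1 n<m))

≡-mod⇒≡ : ∀ c .{{_ : NonZero c}} {x y} → 1 ≤ x → x ≤ c → 1 ≤ y → y ≤ c → x % c ≡ y % c → x ≡ y
≡-mod⇒≡ c {x} {y} 1≤x x≤c 1≤y y≤c x≡y with m≤n⇒m<n∨m≡n x≤c | m≤n⇒m<n∨m≡n y≤c
... | inj₁ x<c | inj₁ y<c = trans (sym (m<n⇒m%n≡m x<c)) (trans x≡y (m<n⇒m%n≡m y<c))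
... | inj₁ x<c | inj₂ refl = contradiction (trans (sym (m<n⇒m%n≡m x<c)) (trans x≡y (n%n≡0 c))) (≢-sym (<⇒≢ 1≤x))
... | inj₂ refl | inj₁ y<c = contradiction (trans (sym (m<n⇒m%n≡m y<c)) (trans (sym x≡y) (n%n≡0 c))) (≢-sym (<⇒≢ 1≤y))
... | inj₂ refl | inj₂ refl = refl

module _ (a c : ℕ) .{{_ : NonZero c}} where

  private
    t = ⌈ a / c ⌉

    c∸1+1≡c : c ∸ 1 + 1 ≡ c
    c∸1+1≡c = trans (+-comm (c ∸ 1) 1) (m+[n∸m]≡n (>-nonZero⁻¹ c))

  m≤⌈m/n⌉*n : a ≤ t * c
  m≤⌈m/n⌉*n = +-cancelʳ-≤ (c ∸ 1) a (t * c) (m<1+n⇒m≤n (begin-strict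
    a + (c ∸ 1)                        ≡⟨ m≡m%n+[m/n]*n (a + (c ∸ 1)) c ⟩
    (a + (c ∸ 1)) % c + t * c          <⟨ +-monoˡ-< (t * c) (m%n<n (a + (c ∸ 1)) c) ⟩
    c + t * c                          ≡⟨ cong (_+ t * c) c∸1+1≡c ⟨
    c ∸ 1 + 1 + t * c                  ≡⟨ trans (+-assoc (c ∸ 1) 1 (t * c)) (+-comm (c ∸ 1) _) ⟩
    suc (t * c + (c ∸ 1))              ∎))
    where open ≤-Reasoning

  [⌈m/n⌉∸1]*n<m : 1 ≤ t → (t ∸ 1) * c < a
  [⌈m/n⌉∸1]*n<m 1≤t = +-cancelʳ-≤ (c ∸ 1) _ a (begin
    suc ((t ∸ 1) * c) + (c ∸ 1)        ≡⟨ +-comm (suc ((t ∸ 1) * c)) (c ∸ 1) ⟩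
    c ∸ 1 + suc ((t ∸ 1) * c)          ≡⟨ +-suc (c ∸ 1) _ ⟩
    suc (c ∸ 1 + (t ∸ 1) * c)          ≡⟨ cong (_+ (t ∸ 1) * c) (trans (+-comm 1 (c ∸ 1)) c∸1+1≡c) ⟩
    c + (t ∸ 1) * c                    ≡⟨ cong (_* c) (m+[n∸m]≡n 1≤t) ⟩
    t * c                              ≤⟨ m/n*n≤m (a + (c ∸ 1)) c ⟩
    a + (c ∸ 1)                        ∎)
    where open ≤-Reasoning

  1≤⌈m/n⌉ : 1 ≤ a → 1 ≤ t
  1≤⌈m/n⌉ 1≤a = m≥n⇒m/n>0 (begin
    c               ≡⟨ c∸1+1≡c ⟨
    c ∸ 1 + 1       ≤⟨ +-monoʳ-≤ (c ∸ 1) 1≤a ⟩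
    c ∸ 1 + a       ≡⟨ +-comm (c ∸ 1) a ⟩
    a + (c ∸ 1)     ∎)
    where open ≤-Reasoning

  ⌈m/n⌉≤o : ∀ {o} → 1 ≤ a → a ≤ o * c → t ≤ o
  ⌈m/n⌉≤o {o} 1≤a a≤o*c = begin
    t                ≡⟨ m+[n∸m]≡n (1≤⌈m/n⌉ 1≤a) ⟨
    suc (t ∸ 1)      ≤⟨ *-cancelʳ-< _ (t ∸ 1) o (<-≤-trans ([⌈m/n⌉∸1]*n<m (1≤⌈m/n⌉ 1≤a)) a≤o*c) ⟩
    o                ∎
    where open ≤-Reasoning

  -- The representative λ′ ∈ [1, c] of a mod c measures how far a exceeds (t − 1) c.
  m≡λ*⌈m/n⌉+[n∸λ]*[⌈m/n⌉∸1] : ∀ {λ′} → 1 ≤ a → 1 ≤ λ′ → λ′ ≤ c → λ′ % c ≡ a % c →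
                              a ≡ λ′ * t + (c ∸ λ′) * (t ∸ 1)
  m≡λ*⌈m/n⌉+[n∸λ]*[⌈m/n⌉∸1] {λ′} 1≤a 1≤λ′ λ′≤c λ′≡a = begin
    a                                      ≡⟨ m∸n+n≡m (<⇒≤ below) ⟨
    excess + (t ∸ 1) * c                   ≡⟨ cong (_+ (t ∸ 1) * c) λ′≡excess ⟨
    λ′ + (t ∸ 1) * c                       ≡⟨ cong (λ k → λ′ + (t ∸ 1) * k) (m+[n∸m]≡n λ′≤c) ⟨
    λ′ + (t ∸ 1) * (λ′ + (c ∸ λ′))
      ≡⟨ solve 3 (λ l u d → l :+ u :* (l :+ d) := l :* (con 1 :+ u) :+ d :* u) refl λ′ (t ∸ 1) (c ∸ λ′) ⟩
    λ′ * (1 + (t ∸ 1)) + (c ∸ λ′) * (t ∸ 1) ≡⟨ cong (λ k → λ′ * k + (c ∸ λ′) * (t ∸ 1)) (m+[n∸m]≡n 1≤t) ⟩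
    λ′ * t + (c ∸ λ′) * (t ∸ 1)            ∎
    where
    open ≡-Reasoning
    1≤t : 1 ≤ t
    1≤t = 1≤⌈m/n⌉ 1≤a
    below : (t ∸ 1) * c < a
    below = [⌈m/n⌉∸1]*n<m 1≤t
    excess : ℕ
    excess = a ∸ (t ∸ 1) * c
    excess≤c : excess ≤ c
    excess≤c = m≤n+o⇒m∸n≤o a _ (≤-trans m≤⌈m/n⌉*n (≤-reflexive (trans (cong (_* c) (sym (m+[n∸m]≡n 1≤t))) (+-comm c _))))
    λ′≡excess : λ′ ≡ excess
    λ′≡excess = ≡-mod⇒≡ c 1≤λ′ λ′≤c (m<n⇒0<n∸m below) excess≤c (begin
      λ′ % c                              ≡⟨ λ′≡a ⟩
      a % c                               ≡⟨ cong (_% c) (m∸n+n≡m (<⇒≤ below)) ⟨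
      (excess + (t ∸ 1) * c) % c          ≡⟨ [m+kn]%n≡m%n excess (t ∸ 1) c ⟩
      excess % c                          ∎)

module _ {q n} (𝒞 : Code q n) {λ′ m s t M : ℕ} (1≤t : 1 ≤ t) (t≤n : t ≤ n)
         (fp : IsFrameproof (λ′ + m) s 𝒞) (s≤λ′+m : s ≤ λ′ + m) (sn≤ : s * n ≤ λ′ * t + m * (t ∸ 1))
         (isM : IsM n t λ′ (s + 1) (λ′ + m ∸ s + 1) M) where

  open WeightedClaims 𝒞 t

  private
    Ts : List (Subset n)
    Ts = subsetsOfSize n t

    t∸1≤∣⊤∣ : t ∸ 1 ≤ ∣ ⊤ {n} ∣
    t∸1≤∣⊤∣ = ≤-trans (≤-trans (m∸n≤m t 1) t≤n) (≤-reflexive (sym (∣⊤∣≡n n)))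

  small-sets-confusable : ∀ {x} → chosen x ≡ nothing → ∀ p → ∣ p ∣ ≤ t ∸ 1 → Confusable 𝒞 p x
  small-sets-confusable {x} chosen≡nothing p ∣p∣≤
    with p′ , p⊆p′ , _ , ∣p′∣≡t∸1 ← ⊆-between {p = p} (t ∸ 1) ⊆⊤ ∣p∣≤ t∸1≤∣⊤∣
    = confusable-⊆ 𝒞 p⊆p′ (¬identifies⇒confusable 𝒞 {p′}
        (find-nothing (λ S → identifies? 𝒞 S x) (subsetsOfSize n (t ∸ 1)) chosen≡nothing
                      (∈-subsetsOfSize⁺ n (t ∸ 1) p′ ∣p′∣≡t∸1)))

  non-identifying-admissible : ∀ {x} → x ∈ˡ words 𝒞 → chosen x ≡ nothing →
    IsAdmissibleFamily n t λ′ (s + 1) (λ′ + m ∸ s + 1) (filter (λ T → ¬? (identifies? 𝒞 T x)) Ts)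
  non-identifying-admissible {x} x∈ chosen≡nothing =
    Uniqueₚ.filter⁺ _ (subsetsOfSize-unique n t) ,
    All.tabulate (λ T∈ → ∈-subsetsOfSize⁻ n t (proj₁ (∈-filter⁻ _ {xs = Ts} T∈))) ,
    λ A A∈ → frameproof⇒¬confusable-disjointSeq 𝒞 fp s≤λ′+m sn≤ x∈ (small-sets-confusable chosen≡nothing) A
               (λ j → ∈-subsetsOfSize⁻ n t (proj₁ (∈-filter⁻ _ {xs = Ts} (A∈ j))))
               (λ j → ¬identifies⇒confusable 𝒞 {A j} (proj₂ (∈-filter⁻ _ {xs = Ts} (A∈ j))))

  t*[N∸M]≤totalWeight : t * ((n C t) ∸ M) ≤ q * (n ∸ t + 1) → ∀ {x} → x ∈ˡ words 𝒞 → t * ((n C t) ∸ M) ≤ totalWeight x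
  t*[N∸M]≤totalWeight t*[N∸M]≤ {x} x∈ = by-cases (chosen x) refl
    where
    by-cases : ∀ c → chosen x ≡ c → t * ((n C t) ∸ M) ≤ totalWeight x
    by-cases (just S) eq = begin
      t * ((n C t) ∸ M)      ≤⟨ t*[N∸M]≤ ⟩
      q * (n ∸ t + 1)        ≡⟨ cong (q *_) (m∸n+1≡m∸[n∸1] 1≤t t≤n) ⟩
      q * (n ∸ (t ∸ 1))      ≤⟨ chosen≡just⇒q*[n∸[t∸1]]≤totalWeight 1≤t eq ⟩
      totalWeight x          ∎
      where open ≤-Reasoning
    by-cases nothing eq = begin
      t * ((n C t) ∸ M)                    ≤⟨ *-monoʳ-≤ t (∸-monoʳ-≤ (n C t) ∣nonIds∣≤M) ⟩
      t * ((n C t) ∸ length nonIds)        ≡⟨ cong (λ k → t * (k ∸ length nonIds)) N≡ ⟩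
      t * (length ids + length nonIds ∸ length nonIds) ≡⟨ cong (t *_) (m+n∸n≡m (length ids) (length nonIds)) ⟩
      t * length ids                       ≡⟨ chosen≡nothing⇒totalWeight≡ eq ⟨
      totalWeight x                        ∎
      where
      open ≤-Reasoning
      ids nonIds : List (Subset n)
      ids    = filter (λ T → identifies? 𝒞 T x) Ts
      nonIds = filter (λ T → ¬? (identifies? 𝒞 T x)) Ts
      ∣nonIds∣≤M : length nonIds ≤ M
      ∣nonIds∣≤M = proj₂ isM nonIds (non-identifying-admissible x∈ eq)
      N≡ : n C t ≡ length ids + length nonIds
      N≡ = trans (sym (length-subsetsOfSize n t)) (sym (length-filter+length-filter¬ (λ T → identifies? 𝒞 T x) Ts))

  frameproof-bound : t * ((n C t) ∸ M) ≤ q * (n ∸ t + 1) → length (words 𝒞) * ((n C t) ∸ M) ≤ (n C t) * q ^ t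
  frameproof-bound t*[N∸M]≤ = *-cancelˡ-≤ t {{>-nonZero 1≤t}} (begin
    t * (length (words 𝒞) * ((n C t) ∸ M))   ≡⟨ x*[y*z]≡y*[x*z] t (length (words 𝒞)) _ ⟩
    length (words 𝒞) * (t * ((n C t) ∸ M))   ≡⟨ ∑-const (words 𝒞) _ ⟨
    ∑[ _ ← words 𝒞 ] (t * ((n C t) ∸ M))     ≤⟨ ∑-mono-≤ (words 𝒞) (t*[N∸M]≤totalWeight t*[N∸M]≤) ⟩
    ∑[ x ← words 𝒞 ] totalWeight x          ≤⟨ ∑-totalWeight≤ ⟩
    (n C t) * (t * q ^ t)                    ≡⟨ x*[y*z]≡y*[x*z] (n C t) t _ ⟩
    t * ((n C t) * q ^ t)                    ∎)
    where open ≤-Reasoning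

-- The hypothesis 2 ≤ c is implied by 1 ≤ s ≤ c ∸ 1.
theorem3p1 : (n c s q λ′ M : ℕ) → .{{_ : NonZero c}} →
  2 ≤ n → 2 ≤ c → 1 ≤ s → s ≤ c ∸ 1 →
  1 ≤ λ′ → λ′ ≤ c → λ′ % c ≡ (s * n) % c →
  IsM n ⌈ s * n / c ⌉ λ′ (s + 1) (c ∸ s + 1) M →
  ⌈ s * n / c ⌉ * ((n C ⌈ s * n / c ⌉) ∸ M) ≤ q * (n ∸ ⌈ s * n / c ⌉ + 1) →
  (𝒞 : Code q n) → IsFrameproof c s 𝒞 →
  length (words 𝒞) * ((n C ⌈ s * n / c ⌉) ∸ M) ≤ (n C ⌈ s * n / c ⌉) * q ^ ⌈ s * n / c ⌉
theorem3p1 n c s q λ′ M 2≤n _ 1≤s s≤c∸1 1≤λ′ λ′≤c λ′≡sn isM t*[N∸M]≤ 𝒞 fp =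
  frameproof-bound 𝒞 (1≤⌈m/n⌉ (s * n) c 1≤sn) t≤n
    (subst (λ k → IsFrameproof k s 𝒞) c≡λ′+[c∸λ′] fp) (subst (s ≤_) c≡λ′+[c∸λ′] s≤c)
    (≤-reflexive (m≡λ*⌈m/n⌉+[n∸λ]*[⌈m/n⌉∸1] (s * n) c 1≤sn 1≤λ′ λ′≤c λ′≡sn))
    (subst (λ k → IsM n ⌈ s * n / c ⌉ λ′ (s + 1) (k ∸ s + 1) M) c≡λ′+[c∸λ′] isM)
    t*[N∸M]≤
  where
  c≡λ′+[c∸λ′] : c ≡ λ′ + (c ∸ λ′)
  c≡λ′+[c∸λ′] = sym (m+[n∸m]≡n λ′≤c)
  s≤c : s ≤ c
  s≤c = ≤-trans s≤c∸1 (m∸n≤m c 1)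
  1≤sn : 1 ≤ s * n
  1≤sn = *-mono-≤ 1≤s (≤-trans (s≤s z≤n) 2≤n)
  t≤n : ⌈ s * n / c ⌉ ≤ n
  t≤n = ⌈m/n⌉≤o (s * n) c 1≤sn (≤-trans (*-monoˡ-≤ n s≤c) (≤-reflexive (*-comm c n)))
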